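{- For every integer $\gamma\ge0$, the map sending, for each $a\in[\gamma]$, both basis words $0a$ and $a0$ of $\mathsf{Dias}_\gamma(2)$ to the $\gamma$-corolla of arity $2$ labeled $a$ extends in a unique way to an operad morphism $\eta_\gamma:\mathsf{Dias}_\gamma\to\mathsf{As}_\gamma$, and this morphism is surjective.
   Context: All operads are nonsymmetric operads over a field $\mathbb{K}$ of characteristic zero. $[n]=\{1,\dots,n\}$, $a\uparrow a'=\max(a,a')$. $\mathsf{Dias}_\gamma$: $\mathsf{Dias}_\gamma(n)$ has basis the words of length $n$ on $\{0,1,\dots,\gamma\}$ with exactly one occurrence of $0$, and $x\circ_iy=x_1\cdots x_{i-1}\max(x_i,y_1)\cdots\max(x_i,y_m)x_{i+1}\cdots x_n$ for $x=x_1\cdots x_n$, $y=y_1\cdots y_m$; it is generated by its arity-$2$ component. $\mathsf{As}_\gamma$ is realized as the operad of $\gamma$-corollas: $\mathsf{As}_\gamma(n)$ has basis the rooted planar trees with $n$ leaves and one internal node labeled by an element of $[\gamma]$ (for $n\ge2$; $\mathsf{As}_\gamma(1)$ is spanned by the unit), and the composition $\mathfrak{c}_1\circ_i\mathfrak{c}_2$ of corollas with $n$ and $m$ leaves labeled $a,a'$ is the corolla with $n+m-1$ leaves labeled $a\uparrow a'$, for all valid $i$. Equivalently, $\mathsf{As}_\gamma$ is generated by binary $\star_a$ with relations $\star_a\circ_1\star_{a'}=\star_{a\uparrow a'}\circ_2\star_{a\uparrow a'}=\star_a\circ_2\star_{a'}$. -}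

module Defs where

open import Level using (Level; _⊔_) renaming (suc to lsuc)
open import Data.Nat using (ℕ; zero; suc; _+_; _≤_; z≤n; s≤s; _≟_; _≤?_)
open import Data.Nat.Properties using (≡-irrelevant; ≤-irrelevant; +-suc; m≤n+m; +-assoc; m+n≤o⇒n≤o)
open import Data.Fin using (Fin; zero; suc)
import Data.Fin as Fin
open import Data.Fin.Properties using () renaming (_≟_ to _≟F_)
open import Data.Vec using (Vec; []; _∷_; map; _++_)
open import Data.List using (List; []; _∷_; foldr) renaming (map to lmap; _++_ to _l++_)
open import Data.List using (concatMap)
open import Data.Product using (Σ; _,_; _×_; proj₁; proj₂; ∃)
open import Data.Empty using (⊥; ⊥-elim)
open import Relation.Nullary using (¬_; Dec; yes; no)
open import Relation.Binary.PropositionalEquality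
  using (_≡_; refl; sym; trans; cong; cong₂; subst)
open import Algebra.Bundles using (CommutativeRing; Semiring)
import Algebra.Definitions.RawSemiring as RS

record Field (c ℓ : Level) : Set (lsuc (c ⊔ ℓ)) where
  field
    commutativeRing : CommutativeRing c ℓ
  open CommutativeRing commutativeRing public
  field
    1≉0     : ¬ (1# ≈ 0#)
    inverse : ∀ x → ¬ (x ≈ 0#) → Σ Carrier (λ y → x * y ≈ 1#)

CharZero : ∀ {c ℓ} → Field c ℓ → Set ℓ
CharZero F = ∀ n → ¬ (suc n ·1 ≈ 0#)
  where open Field F
        open RS (Semiring.rawSemiring semiring) using () renaming (_×_ to _·_)
        _·1 : ℕ → Carrier
        k ·1 = k · 1#

maxF : ∀ {k} → Fin k → Fin k → Fin k
maxF zero    y       = y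
maxF (suc x) zero    = suc x
maxF (suc x) (suc y) = suc (maxF x y)

module Dias (γ : ℕ) where

  Letter : Set
  Letter = Fin (suc γ)

  zeros : ∀ {n} → Vec Letter n → ℕ
  zeros []           = 0
  zeros (zero  ∷ w)  = suc (zeros w)
  zeros (suc _ ∷ w)  = zeros w

  Basis : ℕ → Set
  Basis n = Σ (Vec Letter n) (λ w → zeros w ≡ 1)

  -- x ∘_i y on words, where i = l + 1 and x has length l + 1 + r
  ins : ∀ l {r m} → Vec Letter (l + suc r) → Vec Letter m → Vec Letter (l + (m + r))
  ins zero    (a ∷ zs) ys = map (maxF a) ys ++ zs
  ins (suc l) (x ∷ xs) ys = x ∷ ins l xs ys

  private
    zeros-++ : ∀ {n m} (u : Vec Letter n) (v : Vec Letter m) → zeros (u ++ v) ≡ zeros u + zeros v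
    zeros-++ []          v = refl
    zeros-++ (zero  ∷ u) v = cong suc (zeros-++ u v)
    zeros-++ (suc _ ∷ u) v = zeros-++ u v

    zeros-map0 : ∀ {m} (ys : Vec Letter m) → zeros (map (maxF zero) ys) ≡ zeros ys
    zeros-map0 []          = refl
    zeros-map0 (zero  ∷ ys) = cong suc (zeros-map0 ys)
    zeros-map0 (suc _ ∷ ys) = zeros-map0 ys

    zeros-mapS : ∀ {m} (a : Fin γ) (ys : Vec Letter m) → zeros (map (maxF (suc a)) ys) ≡ 0
    zeros-mapS a []           = refl
    zeros-mapS a (zero  ∷ ys) = zeros-mapS a ys
    zeros-mapS a (suc _ ∷ ys) = zeros-mapS a ys

  zeros-ins : ∀ l {r m} (x : Vec Letter (l + suc r)) (y : Vec Letter m) →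
              zeros y ≡ 1 → zeros (ins l x y) ≡ zeros x
  zeros-ins zero (zero ∷ zs) ys p =
    trans (zeros-++ (map (maxF zero) ys) zs)
          (cong (_+ zeros zs) (trans (zeros-map0 ys) p))
  zeros-ins zero (suc a ∷ zs) ys p =
    trans (zeros-++ (map (maxF (suc a)) ys) zs) (cong (_+ zeros zs) (zeros-mapS a ys))
  zeros-ins (suc l) (zero  ∷ xs) ys p = cong suc (zeros-ins l xs ys p)
  zeros-ins (suc l) (suc _ ∷ xs) ys p = zeros-ins l xs ys p

  comp : ∀ l r m → Basis (l + suc r) → Basis m → Basis (l + (m + r))
  comp l r m (x , p) (y , q) = ins l x y , trans (zeros-ins l x y q) p

  unit : Basis 1
  unit = zero ∷ [] , refl

  w0a : Fin γ → Basis 2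
  w0a a = zero ∷ suc a ∷ [] , refl

  wa0 : Fin γ → Basis 2
  wa0 a = suc a ∷ zero ∷ [] , refl

-- The operad As_γ of γ-corollas.  Basis of As_γ(n): the unit if n = 1,
-- the corollas with n leaves labeled by a ∈ [γ] (Fin γ) if n ≥ 2.

module As (γ : ℕ) where

  data Cor (n : ℕ) : Set where
    unitC : n ≡ 1 → Cor n
    cor   : 2 ≤ n → Fin γ → Cor n

  private
    lemUU : ∀ l r m → l + suc r ≡ 1 → m ≡ 1 → l + (m + r) ≡ 1
    lemUU zero    zero    m p q = trans (cong (_+ 0) q) refl
    lemUU zero    (suc r) m () q
    lemUU (suc zero) r m () q
    lemUU (suc (suc l)) r m () q

    lemR : ∀ l r m → 2 ≤ m → 2 ≤ l + (m + r)
    lemR l r m p = Data.Nat.Properties.≤-trans p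
                    (Data.Nat.Properties.≤-trans (Data.Nat.Properties.m≤m+n m r) (m≤n+m (m + r) l))

    lemL : ∀ l r m → 2 ≤ l + suc r → m ≡ 1 → 2 ≤ l + (m + r)
    lemL l r m p refl = p

  comp : ∀ l r m → Cor (l + suc r) → Cor m → Cor (l + (m + r))
  comp l r m (unitC p) (unitC q) = unitC (lemUU l r m p q)
  comp l r m (unitC p) (cor q b) = cor (lemR l r m q) b
  comp l r m (cor p a) (unitC q) = cor (lemL l r m p q) a
  comp l r m (cor p a) (cor q b) = cor (lemR l r m q) (maxF a b)

  _≟C_ : ∀ {n} (u v : Cor n) → Dec (u ≡ v)
  unitC p ≟C unitC q = yes (cong unitC (≡-irrelevant p q))
  unitC p ≟C cor q b = no (λ ())
  cor p a ≟C unitC q = no (λ ())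
  cor p a ≟C cor q b with a ≟F b
  ... | yes refl = yes (cong (λ z → cor z a) (≤-irrelevant p q))
  ... | no a≢b   = no (λ { refl → a≢b refl })

  enum : ∀ n → List (Cor n)
  enum n = unitPart (n ≟ 1) l++ corPart (2 ≤? n)
    where
      unitPart : Dec (n ≡ 1) → List (Cor n)
      unitPart (yes p) = unitC p ∷ []
      unitPart (no _)  = []
      corPart : Dec (2 ≤ n) → List (Cor n)
      corPart (yes p) = lmap (cor p) (Data.List.allFin γ)
      corPart (no _)  = []

-- Linear maps Dias_γ(n) → As_γ(n), given by their values on the basis
-- (an element of As_γ(n) is a coefficient function Cor n → K).

module Morphisms {c ℓ} (K : Field c ℓ) (γ : ℕ) where
  open Field K using (Carrier; _≈_; 0#; 1#) renaming (_+_ to _+K_; _*_ to _*K_)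
  open Dias γ using (Basis)
  open As γ using (Cor; _≟C_; enum)

  Σl : ∀ {a} {A : Set a} → List A → (A → Carrier) → Carrier
  Σl xs f = foldr (λ x s → f x +K s) 0# xs

  e : ∀ {n} → Cor n → (Cor n → Carrier)
  e u w with u ≟C w
  ... | yes _ = 1#
  ... | no  _ = 0#

  LinFam : Set c
  LinFam = ∀ n → Basis n → Cor n → Carrier

  compAs : ∀ l r m → (Cor (l + suc r) → Carrier) → (Cor m → Carrier) →
           Cor (l + (m + r)) → Carrier
  compAs l r m p q w =
    Σl (enum (l + suc r)) λ u → Σl (enum m) λ v →
      e (As.comp γ l r m u v) w *K (p u *K q v)

  IsOperadMorphism : LinFam → Set ℓ
  IsOperadMorphism η =
    (∀ w → η 1 (Dias.unit γ) w ≈ e (As.unitC refl) w) ×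
    (∀ l r m (x : Basis (l + suc r)) (y : Basis m) (w : Cor (l + (m + r))) →
       η (l + (m + r)) (Dias.comp γ l r m x y) w ≈ compAs l r m (η (l + suc r) x) (η m y) w)

  ExtendsGen : LinFam → Set ℓ
  ExtendsGen η =
    ∀ (a : Fin γ) (w : Cor 2) →
      (η 2 (Dias.w0a γ a) w ≈ e (As.cor (s≤s (s≤s z≤n)) a) w) ×
      (η 2 (Dias.wa0 γ a) w ≈ e (As.cor (s≤s (s≤s z≤n)) a) w)

  Surjective : LinFam → Set (c ⊔ ℓ)
  Surjective η =
    ∀ n (v : Cor n → Carrier) →
      Σ (List (Carrier × Basis n)) λ xs →
        ∀ w → Σl xs (λ kx → proj₁ kx *K η n (proj₂ kx) w) ≈ v w

-- η_γ sends a word to the corolla labelled by its largest letter (the unit for the word 0);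
-- a word of arity ≥ 2 has exactly one 0, so its largest letter is nonzero. The largest
-- letter of x ∘ᵢ y is the max of those of x and y, so η_γ is an operad morphism already on
-- bases, and 0a…a ↦ a shows that it is surjective. For uniqueness, every word of arity ≥ 3
-- is y ∘₁ g with g of arity 2 (give g the larger of the first two letters), and every word
-- of arity 2 is a generator, so a morphism is determined by the prescribed values.
module Submission where

open import Defs
open import Level using (0ℓ)
open import Data.Nat using (ℕ; zero; suc; _+_; z≤n; s≤s)
open import Data.Nat.Properties using (≡-irrelevant; ≤-irrelevant)
open import Data.Fin using (Fin; zero; suc; punchOut)
open import Data.Fin.Properties using (punchIn-punchOut; suc-injective)
open import Data.Vec using (Vec; []; _∷_; _++_; map; replicate)
open import Data.List using (List; []; _∷_; allFin) renaming (map to lmap)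
open import Data.List.Properties using (foldr-map; map-tabulate)
open import Data.Product using (Σ; _×_; _,_; proj₁; proj₂; ∃)
open import Data.Sum using (_⊎_; inj₁; inj₂)
open import Function using (_∘_; id)
open import Relation.Nullary using (yes; no; contradiction)
open import Relation.Binary.PropositionalEquality
  using (_≡_; _≢_; refl; sym; trans; cong; cong₂; subst; isEquivalence; module ≡-Reasoning)
open import Algebra.Bundles using (IdempotentCommutativeMonoid)
open import Algebra.Definitions using (LeftConical)

maxF-identityʳ : ∀ {k} (a : Fin (suc k)) → maxF a zero ≡ a
maxF-identityʳ zero    = refl
maxF-identityʳ (suc a) = refl

maxF-comm : ∀ {k} (a b : Fin k) → maxF a b ≡ maxF b a
maxF-comm zero    b       = sym (maxF-identityʳ b)
maxF-comm (suc a) zero    = refl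
maxF-comm (suc a) (suc b) = cong suc (maxF-comm a b)

maxF-assoc : ∀ {k} (a b c : Fin k) → maxF (maxF a b) c ≡ maxF a (maxF b c)
maxF-assoc zero    b       c       = refl
maxF-assoc (suc a) zero    c       = refl
maxF-assoc (suc a) (suc b) zero    = refl
maxF-assoc (suc a) (suc b) (suc c) = cong suc (maxF-assoc a b c)

maxF-idem : ∀ {k} (a : Fin k) → maxF a a ≡ a
maxF-idem zero    = refl
maxF-idem (suc a) = cong suc (maxF-idem a)

maxF-total : ∀ {k} (a b : Fin k) → maxF a b ≡ b ⊎ maxF b a ≡ a
maxF-total zero    b       = inj₁ refl
maxF-total (suc a) zero    = inj₂ refl
maxF-total (suc a) (suc b) with maxF-total a b
... | inj₁ eq = inj₁ (cong suc eq)
... | inj₂ eq = inj₂ (cong suc eq)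

maxF-conicalˡ : ∀ {k} → LeftConical _≡_ zero (maxF {suc k})
maxF-conicalˡ zero    b       _  = refl
maxF-conicalˡ (suc a) zero    ()
maxF-conicalˡ (suc a) (suc b) ()

maxF-idempotentCommutativeMonoid : ℕ → IdempotentCommutativeMonoid 0ℓ 0ℓ
maxF-idempotentCommutativeMonoid k = record
  { Carrier = Fin (suc k)
  ; _≈_     = _≡_
  ; _∙_     = maxF
  ; ε       = zero
  ; isIdempotentCommutativeMonoid = record
    { isCommutativeMonoid = record
      { isMonoid = record
        { isSemigroup = record
          { isMagma = record { isEquivalence = isEquivalence ; ∙-cong = cong₂ maxF }
          ; assoc   = maxF-assoc
          }
        ; identity = (λ _ → refl) , maxF-identityʳ
        }
      ; comm = maxF-comm
      }
    ; idem = maxF-idem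
    }
  }

module Words (γ : ℕ) where
  open Dias γ using (Letter; zeros; Basis; ins)
  open As γ using (Cor; unitC; cor)
  open import Algebra.Properties.IdempotentCommutativeMonoid
    (maxF-idempotentCommutativeMonoid γ) using (∙-distrˡ-∙)
  open import Algebra.Properties.CommutativeSemigroup
    (IdempotentCommutativeMonoid.commutativeSemigroup (maxF-idempotentCommutativeMonoid γ))
    using (xy∙z≈xz∙y)

  Basis-≡ : ∀ {n} {x y : Basis n} → proj₁ x ≡ proj₁ y → x ≡ y
  Basis-≡ {x = _ , p} {_ , q} refl = cong (_ ,_) (≡-irrelevant p q)

  maxLetter : ∀ {n} → Vec Letter n → Letter
  maxLetter []      = zero
  maxLetter (a ∷ v) = maxF a (maxLetter v)

  maxLetter-++ : ∀ {n m} (u : Vec Letter n) (v : Vec Letter m) →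
                 maxLetter (u ++ v) ≡ maxF (maxLetter u) (maxLetter v)
  maxLetter-++ []      v = refl
  maxLetter-++ (a ∷ u) v =
    trans (cong (maxF a) (maxLetter-++ u v)) (sym (maxF-assoc a (maxLetter u) (maxLetter v)))

  maxLetter-map : ∀ {m} (a : Letter) (v : Vec Letter (suc m)) →
                  maxLetter (map (maxF a) v) ≡ maxF a (maxLetter v)
  maxLetter-map a (b ∷ [])    =
    trans (maxF-identityʳ (maxF a b)) (cong (maxF a) (sym (maxF-identityʳ b)))
  maxLetter-map a (b ∷ c ∷ v) =
    trans (cong (maxF (maxF a b)) (maxLetter-map a (c ∷ v)))
          (sym (∙-distrˡ-∙ a b (maxLetter (c ∷ v))))

  maxLetter-ins : ∀ l {r m} (x : Vec Letter (l + suc r)) (y : Vec Letter (suc m)) →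
                  maxLetter (ins l x y) ≡ maxF (maxLetter x) (maxLetter y)
  maxLetter-ins zero    (a ∷ z) y =
    trans (maxLetter-++ (map (maxF a) y) z)
          (trans (cong (λ b → maxF b (maxLetter z)) (maxLetter-map a y))
                 (xy∙z≈xz∙y a (maxLetter y) (maxLetter z)))
  maxLetter-ins (suc l) (a ∷ x) y =
    trans (cong (maxF a) (maxLetter-ins l x y)) (sym (maxF-assoc a (maxLetter x) (maxLetter y)))

  maxLetter≡zero⇒zeros≡length : ∀ {n} (v : Vec Letter n) → maxLetter v ≡ zero → zeros v ≡ n
  maxLetter≡zero⇒zeros≡length []          _  = refl
  maxLetter≡zero⇒zeros≡length (zero ∷ v)  eq = cong suc (maxLetter≡zero⇒zeros≡length v eq)
  maxLetter≡zero⇒zeros≡length (suc a ∷ v) eq with maxF-conicalˡ (suc a) (maxLetter v) eq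
  ... | ()

  maxLetter≢zero : ∀ {k} (v : Vec Letter (suc (suc k))) → zeros v ≡ 1 → maxLetter v ≢ zero
  maxLetter≢zero v one eq with trans (sym (maxLetter≡zero⇒zeros≡length v eq)) one
  ... | ()

  label : ∀ {n} → Cor n → Letter
  label (unitC _) = zero
  label (cor _ a) = suc a

  label-injective : ∀ {n} (u v : Cor n) → label u ≡ label v → u ≡ v
  label-injective (unitC p) (unitC q) _    = cong unitC (≡-irrelevant p q)
  label-injective (cor p a) (cor q b) refl = cong (λ r → cor r a) (≤-irrelevant p q)

  label-comp : ∀ l r m (u : Cor (l + suc r)) (v : Cor m) →
               label (As.comp γ l r m u v) ≡ maxF (label u) (label v)
  label-comp l r m (unitC _) (unitC _) = refl
  label-comp l r m (unitC _) (cor _ _) = refl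
  label-comp l r m (cor _ _) (unitC _) = refl
  label-comp l r m (cor _ _) (cor _ _) = refl

  toCorolla : ∀ {n} → Basis n → Cor n
  toCorolla {zero}        ([] , ())
  toCorolla {suc zero}    _       = unitC refl
  toCorolla {suc (suc k)} (v , p) =
    cor (s≤s (s≤s z≤n)) (punchOut (maxLetter≢zero v p ∘ sym))

  label-toCorolla : ∀ {n} (x : Basis n) → label (toCorolla x) ≡ maxLetter (proj₁ x)
  label-toCorolla {zero}        ([] , ())
  label-toCorolla {suc zero}    (zero ∷ [] , _)  = refl
  label-toCorolla {suc zero}    (suc _ ∷ [] , ())
  label-toCorolla {suc (suc k)} (v , p)          = punchIn-punchOut (maxLetter≢zero v p ∘ sym)

  toCorolla-comp : ∀ l r m (x : Basis (l + suc r)) (y : Basis m) →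
                   toCorolla (Dias.comp γ l r m x y) ≡ As.comp γ l r m (toCorolla x) (toCorolla y)
  toCorolla-comp l r zero    x ([] , ())
  toCorolla-comp l r (suc m) x y = label-injective _ _ (begin
    label (toCorolla (Dias.comp γ l r (suc m) x y))           ≡⟨ label-toCorolla (Dias.comp γ l r (suc m) x y) ⟩
    maxLetter (ins l (proj₁ x) (proj₁ y))                    ≡⟨ maxLetter-ins l (proj₁ x) (proj₁ y) ⟩
    maxF (maxLetter (proj₁ x)) (maxLetter (proj₁ y))          ≡⟨ cong₂ maxF (label-toCorolla x) (label-toCorolla y) ⟨
    maxF (label (toCorolla x)) (label (toCorolla y))          ≡⟨ label-comp l r (suc m) (toCorolla x) (toCorolla y) ⟨
    label (As.comp γ l r (suc m) (toCorolla x) (toCorolla y)) ∎)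
    where open ≡-Reasoning

  toCorolla-surjective : ∀ {n} (u : Cor n) → Σ (Basis n) (λ x → toCorolla x ≡ u)
  toCorolla-surjective (unitC refl) = (zero ∷ [] , refl) , refl
  toCorolla-surjective (cor (s≤s (s≤s {n = k} z≤n)) a) =
    x , label-injective _ _ (trans (label-toCorolla x) (maxLetter-replicate k))
    where
    x : Basis (suc (suc k))
    x = zero ∷ replicate (suc k) (suc a) , cong suc (zeros-replicate (suc k))
      where
      zeros-replicate : ∀ j → zeros (replicate j (suc a)) ≡ 0
      zeros-replicate zero    = refl
      zeros-replicate (suc j) = zeros-replicate j
    maxLetter-replicate : ∀ j → maxLetter (replicate (suc j) (suc a)) ≡ suc a
    maxLetter-replicate zero    = refl
    maxLetter-replicate (suc j) = trans (cong (maxF (suc a)) (maxLetter-replicate j)) (maxF-idem (suc a))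

  basis₁ : (x : Basis 1) → x ≡ Dias.unit γ
  basis₁ (zero ∷ [] , _) = Basis-≡ refl
  basis₁ (suc _ ∷ [] , ())

  basis₂ : (x : Basis 2) → ∃ λ a → x ≡ Dias.w0a γ a ⊎ x ≡ Dias.wa0 γ a
  basis₂ (zero  ∷ zero  ∷ [] , ())
  basis₂ (zero  ∷ suc b ∷ [] , _) = b , inj₁ (Basis-≡ refl)
  basis₂ (suc a ∷ zero  ∷ [] , _) = a , inj₂ (Basis-≡ refl)
  basis₂ (suc _ ∷ suc _ ∷ [] , ())

  decompose : ∀ k (x : Basis (suc (suc (suc k)))) →
              Σ (Basis (suc (suc k))) λ y → Σ (Basis 2) λ g → Dias.comp γ 0 (suc k) 2 y g ≡ x
  decompose k (zero  ∷ zero  ∷ _    , ())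
  decompose k (zero  ∷ suc b ∷ rest , p) = (zero ∷ rest , p) , Dias.w0a γ b , Basis-≡ refl
  decompose k (suc a ∷ zero  ∷ rest , p) = (zero ∷ rest , p) , Dias.wa0 γ a , Basis-≡ refl
  decompose k (suc a ∷ suc b ∷ rest , p) with maxF-total (suc a) (suc b)
  ... | inj₁ eq = (suc a ∷ rest , p) , Dias.w0a γ b , Basis-≡ (cong (λ c → suc a ∷ c ∷ rest) eq)
  ... | inj₂ eq = (suc b ∷ rest , p) , Dias.wa0 γ a , Basis-≡ (cong (λ c → c ∷ suc b ∷ rest) eq)

module Linear {c ℓ} (K : Field c ℓ) (γ : ℕ) where
  open Field K hiding (zero)
    renaming (refl to ≈-refl; sym to ≈-sym; trans to ≈-trans; _+_ to _+K_; _*_ to _*K_)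
  open Morphisms K γ
  open Dias γ using (Basis)
  open As γ using (Cor; unitC; cor; _≟C_; enum)
  open Words γ
  open import Relation.Binary.Reasoning.Setoid setoid

  Σl-cong : ∀ {a} {A : Set a} (xs : List A) {f g : A → Carrier} →
            (∀ x → f x ≈ g x) → Σl xs f ≈ Σl xs g
  Σl-cong []       h = ≈-refl
  Σl-cong (x ∷ xs) h = +-cong (h x) (Σl-cong xs h)

  Σl-zero : ∀ {a} {A : Set a} (xs : List A) {f : A → Carrier} → (∀ x → f x ≈ 0#) → Σl xs f ≈ 0#
  Σl-zero []       h = ≈-refl
  Σl-zero (x ∷ xs) h = ≈-trans (+-cong (h x) (Σl-zero xs h)) (+-identityˡ 0#)

  Σl-map : ∀ {a b} {A : Set a} {B : Set b} (g : A → B) (xs : List A) (f : B → Carrier) →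
           Σl (lmap g xs) f ≡ Σl xs (f ∘ g)
  Σl-map g xs f = foldr-map (λ y s → f y +K s) g 0# xs

  Σl-allFin-suc : ∀ {k} (f : Fin (suc k) → Carrier) →
                  Σl (allFin (suc k)) f ≡ f zero +K Σl (allFin k) (f ∘ suc)
  Σl-allFin-suc {k} f = cong (f zero +K_)
    (trans (cong (λ xs → Σl xs f) (sym (map-tabulate id suc))) (Σl-map suc (allFin k) f))

  Σl-allFin-single : ∀ {k} (a : Fin k) (f : Fin k → Carrier) →
                     (∀ b → a ≢ b → f b ≈ 0#) → Σl (allFin k) f ≈ f a
  Σl-allFin-single {suc k} zero f h = begin
    Σl (allFin (suc k)) f                  ≡⟨ Σl-allFin-suc f ⟩
    f zero +K Σl (allFin k) (f ∘ suc)      ≈⟨ +-congˡ (Σl-zero (allFin k) (λ b → h (suc b) λ ())) ⟩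
    f zero +K 0#                           ≈⟨ +-identityʳ _ ⟩
    f zero                                 ∎
  Σl-allFin-single {suc k} (suc a) f h = begin
    Σl (allFin (suc k)) f                  ≡⟨ Σl-allFin-suc f ⟩
    f zero +K Σl (allFin k) (f ∘ suc)      ≈⟨ +-cong (h zero λ ())
                                                (Σl-allFin-single a (f ∘ suc) (λ b → h (suc b) ∘ (_∘ suc-injective))) ⟩
    0# +K f (suc a)                        ≈⟨ +-identityˡ _ ⟩
    f (suc a)                              ∎

  Σl-enum-single : ∀ {n} (t : Cor n) (f : Cor n → Carrier) →
                   (∀ u → t ≢ u → f u ≈ 0#) → Σl (enum n) f ≈ f t
  Σl-enum-single (unitC refl) f h = +-identityʳ _
  Σl-enum-single {suc (suc k)} (cor (s≤s (s≤s z≤n)) a) f h = begin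
    Σl (lmap (cor 2≤n) (allFin γ)) f  ≡⟨ Σl-map (cor 2≤n) (allFin γ) f ⟩
    Σl (allFin γ) (f ∘ cor 2≤n)       ≈⟨ Σl-allFin-single a (f ∘ cor 2≤n)
                                           (λ b a≢b → h (cor 2≤n b) (a≢b ∘ suc-injective ∘ cong label)) ⟩
    f (cor 2≤n a)                     ∎
    where 2≤n = s≤s (s≤s (z≤n {k}))

  e-diag : ∀ {n} (t : Cor n) → e t t ≈ 1#
  e-diag t with t ≟C t
  ... | yes _   = ≈-refl
  ... | no t≢t  = contradiction refl t≢t

  e-off : ∀ {n} {t u : Cor n} → t ≢ u → e t u ≈ 0#
  e-off {t = t} {u} t≢u with t ≟C u
  ... | yes t≡u = contradiction t≡u t≢u
  ... | no _    = ≈-refl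

  Σl-enum-δ : ∀ {n} (t : Cor n) (f : Cor n → Carrier) → Σl (enum n) (λ u → f u *K e t u) ≈ f t
  Σl-enum-δ t f = begin
    Σl (enum _) (λ u → f u *K e t u)  ≈⟨ Σl-enum-single t _ (λ u t≢u → ≈-trans (*-congˡ (e-off t≢u)) (zeroʳ _)) ⟩
    f t *K e t t                      ≈⟨ *-congˡ (e-diag t) ⟩
    f t *K 1#                         ≈⟨ *-identityʳ _ ⟩
    f t                               ∎

  compAs-e : ∀ l r m (s : Cor (l + suc r)) (t : Cor m) w →
             compAs l r m (e s) (e t) w ≈ e (As.comp γ l r m s t) w
  compAs-e l r m s t w = begin
    Σl (enum _) (λ u → Σl (enum m) (λ v → E u v *K (e s u *K e t v)))
      ≈⟨ Σl-cong (enum (l + suc r)) (λ u → Σl-cong (enum m) (λ v → ≈-sym (*-assoc _ _ _))) ⟩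
    Σl (enum _) (λ u → Σl (enum m) (λ v → (E u v *K e s u) *K e t v))
      ≈⟨ Σl-cong (enum (l + suc r)) (λ u → Σl-enum-δ t (λ v → E u v *K e s u)) ⟩
    Σl (enum _) (λ u → E u t *K e s u)
      ≈⟨ Σl-enum-δ s (λ u → E u t) ⟩
    E s t ∎
    where
    E : Cor (l + suc r) → Cor m → Carrier
    E u v = e (As.comp γ l r m u v) w

  compAs-cong : ∀ l r m {p p′ : Cor (l + suc r) → Carrier} {q q′ : Cor m → Carrier} →
                (∀ u → p u ≈ p′ u) → (∀ v → q v ≈ q′ v) →
                ∀ w → compAs l r m p q w ≈ compAs l r m p′ q′ w
  compAs-cong l r m hp hq w =
    Σl-cong (enum (l + suc r)) (λ u → Σl-cong (enum m) (λ v → *-congˡ (*-cong (hp u) (hq v))))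

  η : LinFam
  η n x = e (toCorolla x)

  η-isOperadMorphism : IsOperadMorphism η
  η-isOperadMorphism = (λ _ → ≈-refl) , λ l r m x y w → begin
    e (toCorolla (Dias.comp γ l r m x y)) w            ≡⟨ cong (λ u → e u w) (toCorolla-comp l r m x y) ⟩
    e (As.comp γ l r m (toCorolla x) (toCorolla y)) w  ≈⟨ compAs-e l r m (toCorolla x) (toCorolla y) w ⟨
    compAs l r m (η _ x) (η m y) w                     ∎

  η-extendsGen : ExtendsGen η
  η-extendsGen _ _ = ≈-refl , ≈-refl

  module _ {φ ψ : LinFam} (φ-mor : IsOperadMorphism φ) (ψ-mor : IsOperadMorphism ψ) where

    agree-on-comp : ∀ l r m (x : Basis (l + suc r)) (y : Basis m) →
                    (∀ w → φ _ x w ≈ ψ _ x w) → (∀ w → φ m y w ≈ ψ m y w) →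
                    ∀ w → φ _ (Dias.comp γ l r m x y) w ≈ ψ _ (Dias.comp γ l r m x y) w
    agree-on-comp l r m x y hx hy w = begin
      φ _ (Dias.comp γ l r m x y) w       ≈⟨ proj₂ φ-mor l r m x y w ⟩
      compAs l r m (φ _ x) (φ m y) w      ≈⟨ compAs-cong l r m hx hy w ⟩
      compAs l r m (ψ _ x) (ψ m y) w      ≈⟨ proj₂ ψ-mor l r m x y w ⟨
      ψ _ (Dias.comp γ l r m x y) w       ∎

    agree-from-arity₂ : (∀ x w → φ 2 x w ≈ ψ 2 x w) → ∀ n x w → φ n x w ≈ ψ n x w
    agree-from-arity₂ h₂ zero ([] , ())
    agree-from-arity₂ h₂ (suc zero) x w rewrite basis₁ x =
      ≈-trans (proj₁ φ-mor w) (≈-sym (proj₁ ψ-mor w))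
    agree-from-arity₂ h₂ (suc (suc zero)) = h₂
    agree-from-arity₂ h₂ (suc (suc (suc k))) x w =
      let y , g , y∘₁g≡x = decompose k x in
      subst (λ x → φ _ x w ≈ ψ _ x w) y∘₁g≡x
        (agree-on-comp 0 (suc k) 2 y g (agree-from-arity₂ h₂ (suc (suc k)) y) (h₂ g) w)

  extendsGen-agree : ∀ {φ ψ} → ExtendsGen φ → ExtendsGen ψ → ∀ x w → φ 2 x w ≈ ψ 2 x w
  extendsGen-agree φ-gen ψ-gen x w with basis₂ x
  ... | a , inj₁ refl = ≈-trans (proj₁ (φ-gen a w)) (≈-sym (proj₁ (ψ-gen a w)))
  ... | a , inj₂ refl = ≈-trans (proj₂ (φ-gen a w)) (≈-sym (proj₂ (ψ-gen a w)))

  η-surjective : Surjective η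
  η-surjective n v = lmap (λ u → v u , preimage u) (enum n) , λ w → begin
    Σl (lmap (λ u → v u , preimage u) (enum n)) (λ kx → proj₁ kx *K η n (proj₂ kx) w)
      ≡⟨ Σl-map (λ u → v u , preimage u) (enum n) _ ⟩
    Σl (enum n) (λ u → v u *K e (toCorolla (preimage u)) w)
      ≈⟨ Σl-cong (enum n) (λ u → *-congˡ (reflexive (cong (λ t → e t w) (proj₂ (toCorolla-surjective u))))) ⟩
    Σl (enum n) (λ u → v u *K e u w)
      ≈⟨ Σl-enum-single w _ (λ u w≢u → ≈-trans (*-congˡ (e-off (w≢u ∘ sym))) (zeroʳ _)) ⟩
    v w *K e w w
      ≈⟨ ≈-trans (*-congˡ (e-diag w)) (*-identityʳ _) ⟩
    v w ∎
    where
    preimage : Cor n → Basis n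
    preimage u = proj₁ (toCorolla-surjective u)

proposition3p2p1 : ∀ {c ℓ} (K : Field c ℓ) → CharZero K → (γ : ℕ) →
    let open Morphisms K γ in
    Σ LinFam (λ η →
      (IsOperadMorphism η × ExtendsGen η) ×
      (∀ η′ → IsOperadMorphism η′ → ExtendsGen η′ →
         ∀ n x w → Field._≈_ K (η′ n x w) (η n x w)) ×
      Surjective η)
proposition3p2p1 K _ γ =
  η , (η-isOperadMorphism , η-extendsGen) ,
  (λ η′ η′-mor η′-gen →
     agree-from-arity₂ {η′} {η} η′-mor η-isOperadMorphism
       (extendsGen-agree {η′} {η} η′-gen η-extendsGen)) ,
  η-surjective
  where open Linear K γ
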